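{- Let $n\ge1$ and $\pi_n\in\mathcal{S}_n$ with $D_n=D(\pi_n)$. For each $\ell\in\{1,\dots,n+1\}$, $$\#\{k\in\{1,\dots,n+1\}: D(\pi_{n+1}^{(k,\ell)})-D(\pi_n)=1\}=n-D_n,\qquad \#\{k\in\{1,\dots,n+1\}: D(\pi_{n+1}^{(k,\ell)})-D(\pi_n)=0\}=D_n+1.$$
   Context: $\mathcal{S}_n$ is the symmetric group on $\{1,\dots,n\}$; for $\sigma\in\mathcal{S}_m$, $D(\sigma)=\#\{i\le m-1:\sigma(i)>\sigma(i+1)\}$. Insertion at $(k,\ell)\in\{1,\dots,n+1\}^2$: $\pi^{(k,\ell)}_{n+1}\in\mathcal{S}_{n+1}$ is defined by $\pi_{n+1}(k)=\ell$; for $i<k$: $\pi_{n+1}(i)=\pi_n(i)$ if $\pi_n(i)<\ell$ and $\pi_n(i)+1$ otherwise; for $i>k$: $\pi_{n+1}(i)=\pi_n(i-1)$ if $\pi_n(i-1)<\ell$ and $\pi_n(i-1)+1$ otherwise. -}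

module Defs where

open import Data.Nat using (ℕ; zero; suc; _+_; _∸_; _<_; _<?_)
open import Data.Nat.Properties using (_≟_)
open import Data.Fin using (Fin; toℕ; fromℕ<)
open import Data.Fin.Permutation using (Permutation′; _⟨$⟩ʳ_)
open import Data.List using (List; length; filter; map; upTo)
open import Relation.Nullary using (Dec; yes; no)
open import Relation.Nullary.Decidable using (⌊_⌋)
open import Data.Bool using (if_then_else_)
open import Data.Nat.Properties using (≤-refl)

range1 : ℕ → List ℕ
range1 m = map suc (upTo m)

-- A permutation of {1,…,n} viewed as a function on ℕ (1-indexed values
-- at 1-indexed positions 1..n; values outside 1..n are irrelevant junk).
asFun : {n : ℕ} → Permutation′ n → ℕ → ℕ
asFun {n} π (suc i) with i <? n
... | yes i<n = suc (toℕ (π ⟨$⟩ʳ fromℕ< i<n))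
... | no _ = 0
asFun π zero = 0

des : ℕ → (ℕ → ℕ) → ℕ
des m σ = length (filter (λ i → σ (suc i) <? σ i) (range1 (m ∸ 1)))

shift : ℕ → ℕ → ℕ
shift ℓ v = if ⌊ v <? ℓ ⌋ then v else suc v

insert : (ℕ → ℕ) → ℕ → ℕ → ℕ → ℕ
insert π k ℓ i with i <? k | i ≟ k
... | yes _ | _ = shift ℓ (π i)
... | no _ | yes _ = ℓ
... | no _ | no _ = shift ℓ (π (i ∸ 1))

count : (P : ℕ → Set) → ((k : ℕ) → Dec (P k)) → ℕ → ℕ
count P P? m = length (filter P? (range1 m))

-- Write π as the list xs = π(1) … π(n) and let ys be xs with every entry ≥ ℓ raised by one:
-- ys has the same descents as xs, no entry equal to ℓ, and π^{(k,ℓ)} is ys with ℓ inserted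
-- into its k-th gap. Putting ℓ between neighbours a and b changes the descent number by
-- [ℓ < a] + [b < ℓ] − [b < a] ∈ {0, 1}. Summed over the n + 1 gaps these changes total n − D(π),
-- because every entry of ys lies either above or below ℓ. So the n + 1 new descent numbers,
-- each D(π) or D(π) + 1, add up to (n + 1) D(π) + (n − D(π)): exactly n − D(π) of them are D(π) + 1.

module Submission where

open import Defs
open import Data.Bool using (true; false)
open import Data.List using (List; []; _∷_; length; filter; map; applyUpTo; upTo)
open import Data.List.Properties using (length-map; length-applyUpTo; map-applyUpTo; map-upTo; map-∘; filter-accept; filter-reject)
open import Data.List.Relation.Unary.All using (All; []; _∷_; universal)
open import Data.List.Relation.Unary.All.Properties using (applyUpTo⁺₂; map⁺)
open import Data.Nat using (ℕ; zero; suc; _+_; _*_; _∸_; _≤_; _<_; _≥_; _<?_; z≤n; s≤s; z<s; s<s; s<s⁻¹)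
open import Data.Nat.ListAction using (sum)
open import Data.Nat.Properties
open import Algebra.Properties.CommutativeSemigroup +-commutativeSemigroup using (interchange)
open import Data.Nat.Tactic.RingSolver using (solve-∀)
open import Data.Fin.Permutation using (Permutation′)
open import Data.Product using (_×_; _,_)
open import Data.Sum using (_⊎_; inj₁; inj₂)
import Data.Sum as Sum
open import Function using (_∘_; id; _⇔_; mk⇔; Equivalence)
open import Relation.Nullary using (Dec; _because_; does; yes; no; contradiction)
open import Relation.Unary using (Pred; Decidable)
open import Relation.Binary.PropositionalEquality

𝟙 : ∀ {p} {P : Set p} → Dec P → ℕ
𝟙 (true because _) = 1
𝟙 (false because _) = 0

𝟙-cong : ∀ {p q} {P : Set p} {Q : Set q} → P ⇔ Q → (P? : Dec P) (Q? : Dec Q) → 𝟙 P? ≡ 𝟙 Q?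
𝟙-cong _ (yes _) (yes _) = refl
𝟙-cong _ (no _)  (no _)  = refl
𝟙-cong P⇔Q (yes p) (no ¬q) = contradiction (Equivalence.to P⇔Q p) ¬q
𝟙-cong P⇔Q (no ¬p) (yes q) = contradiction (Equivalence.from P⇔Q q) ¬p

𝟙<+𝟙>≡1 : ∀ {a b} → a ≢ b → 𝟙 (a <? b) + 𝟙 (b <? a) ≡ 1
𝟙<+𝟙>≡1 {a} {b} a≢b with a <? b | b <? a
... | yes a<b | yes b<a = contradiction b<a (<-asym a<b)
... | yes _   | no _    = refl
... | no _    | yes _   = refl
... | no a≮b  | no b≮a  = contradiction (≤-antisym (≮⇒≥ b≮a) (≮⇒≥ a≮b)) a≢b

𝟙<-insert : ∀ a b c →
  𝟙 (c <? a) + 𝟙 (b <? c) ≡ 𝟙 (b <? a) ⊎ 𝟙 (c <? a) + 𝟙 (b <? c) ≡ suc (𝟙 (b <? a))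
𝟙<-insert a b c with b <? a | c <? a | b <? c
... | yes _   | yes _   | yes _   = inj₂ refl
... | yes _   | yes _   | no _    = inj₁ refl
... | yes _   | no _    | yes _   = inj₁ refl
... | yes b<a | no c≮a  | no b≮c  = contradiction (≤-trans (≮⇒≥ c≮a) (≮⇒≥ b≮c)) (<⇒≱ b<a)
... | no b≮a  | yes c<a | yes b<c = contradiction (<-trans b<c c<a) b≮a
... | no _    | yes _   | no _    = inj₂ refl
... | no _    | no _    | yes _   = inj₂ refl
... | no _    | no _    | no _    = inj₁ refl

descentsFrom : ℕ → List ℕ → ℕ
descentsFrom x [] = 0
descentsFrom x (y ∷ ys) = 𝟙 (y <? x) + descentsFrom y ys

-- 0 is a sentinel: no entry lies below it, so prefixing it adds no descent.
descents : List ℕ → ℕ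
descents = descentsFrom 0

module _ {f : ℕ → ℕ} (f-embedding : ∀ {a b} → a < b ⇔ f a < f b) where

  descentsFrom-map : ∀ x ys → descentsFrom (f x) (map f ys) ≡ descentsFrom x ys
  descentsFrom-map x [] = refl
  descentsFrom-map x (y ∷ ys) = cong₂ _+_ (sym (𝟙-cong f-embedding (y <? x) (f y <? f x))) (descentsFrom-map y ys)

  descents-map : ∀ ys → descents (map f ys) ≡ descents ys
  descents-map [] = refl
  descents-map (y ∷ ys) = descentsFrom-map y ys

insertAt : ∀ {a} {A : Set a} → ℕ → A → List A → List A
insertAt zero v xs = v ∷ xs
insertAt (suc j) v [] = v ∷ []
insertAt (suc j) v (x ∷ xs) = x ∷ insertAt j v xs

descentsFrom-insertAt : ∀ x v ys j →
  descentsFrom x (insertAt j v ys) ≡ descentsFrom x ys ⊎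
  descentsFrom x (insertAt j v ys) ≡ suc (descentsFrom x ys)
descentsFrom-insertAt x v [] zero with v <? x
... | yes _ = inj₂ refl
... | no _  = inj₁ refl
descentsFrom-insertAt x v [] (suc j) = descentsFrom-insertAt x v [] zero
descentsFrom-insertAt x v (y ∷ ys) zero =
  Sum.map add-descents add-descents (𝟙<-insert x y v)
  where
  add-descents : ∀ {n} → 𝟙 (v <? x) + 𝟙 (y <? v) ≡ n →
    𝟙 (v <? x) + (𝟙 (y <? v) + descentsFrom y ys) ≡ n + descentsFrom y ys
  add-descents eq = trans (sym (+-assoc (𝟙 (v <? x)) _ _)) (cong (_+ descentsFrom y ys) eq)
descentsFrom-insertAt x v (y ∷ ys) (suc j) =
  Sum.map (cong (𝟙 (y <? x) +_)) (λ eq → trans (cong (𝟙 (y <? x) +_) eq) (+-suc (𝟙 (y <? x)) _))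
    (descentsFrom-insertAt y v ys j)

descents-insertAt : ∀ v ys j →
  descents (insertAt j v ys) ≡ descents ys ⊎ descents (insertAt j v ys) ≡ suc (descents ys)
descents-insertAt = descentsFrom-insertAt 0

sum-applyUpTo-+ : ∀ c (f : ℕ → ℕ) m → sum (applyUpTo (λ i → c + f i) m) ≡ m * c + sum (applyUpTo f m)
sum-applyUpTo-+ c f zero = refl
sum-applyUpTo-+ c f (suc m) = begin
  c + f 0 + sum (applyUpTo (λ i → c + f (suc i)) m)    ≡⟨ cong (c + f 0 +_) (sum-applyUpTo-+ c (f ∘ suc) m) ⟩
  c + f 0 + (m * c + sum (applyUpTo (f ∘ suc) m))      ≡⟨ interchange c (f 0) (m * c) _ ⟩
  c + m * c + (f 0 + sum (applyUpTo (f ∘ suc) m))      ∎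
  where open ≡-Reasoning

descentsFrom-insertAt-sum : ∀ x v ys → All (_≢ v) ys →
  sum (applyUpTo (λ j → descentsFrom x (insertAt j v ys)) (suc (length ys)))
    ≡ length ys * descentsFrom x ys + 𝟙 (v <? x) + length ys
descentsFrom-insertAt-sum x v [] [] = +-identityʳ (𝟙 (v <? x) + 0)
descentsFrom-insertAt-sum x v (y ∷ ys) (y≢v ∷ ys≢v) = begin
  a + (b + d) + sum (applyUpTo (λ j → e + G j) (suc m))  ≡⟨ cong (a + (b + d) +_) (sum-applyUpTo-+ e G (suc m)) ⟩
  a + (b + d) + (suc m * e + sum (applyUpTo G (suc m)))  ≡⟨ cong (λ s → a + (b + d) + (suc m * e + s)) IH ⟩
  a + (b + d) + (suc m * e + (m * d + c + m))            ≡⟨ regroup a b c d e m ⟩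
  (b + c) + (suc m * (e + d) + a + m)                    ≡⟨ cong (_+ (suc m * (e + d) + a + m)) (𝟙<+𝟙>≡1 y≢v) ⟩
  suc (suc m * (e + d) + a + m)                          ≡⟨ +-suc (suc m * (e + d) + a) m ⟨
  suc m * (e + d) + a + suc m                            ∎
  where
  open ≡-Reasoning
  regroup : ∀ a b c d e m →
    a + (b + d) + (suc m * e + (m * d + c + m)) ≡ (b + c) + (suc m * (e + d) + a + m)
  regroup = solve-∀
  a b c d e m : ℕ
  a = 𝟙 (v <? x)
  b = 𝟙 (y <? v)
  c = 𝟙 (v <? y)
  d = descentsFrom y ys
  e = 𝟙 (y <? x)
  m = length ys
  G : ℕ → ℕ
  G j = descentsFrom y (insertAt j v ys)
  IH : sum (applyUpTo G (suc m)) ≡ m * d + c + m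
  IH = descentsFrom-insertAt-sum y v ys ys≢v

descents-insertAt-sum : ∀ {v ys m D} → All (_≢ v) ys → length ys ≡ m → descents ys ≡ D →
  sum (applyUpTo (λ j → descents (insertAt j v ys)) (suc m)) ≡ m * D + m
descents-insertAt-sum {v} {ys} ys≢v refl refl =
  trans (descentsFrom-insertAt-sum 0 v ys ys≢v) (cong (_+ length ys) (+-identityʳ _))

occurrences : ℕ → List ℕ → ℕ
occurrences c vs = length (filter (_≟ c) vs)

module _ {D : ℕ} where

  private
    D≢D+1 : D ≢ D + 1
    D≢D+1 = <⇒≢ (m<m+n D z<s)

    1+D≡D+1 : suc D ≡ D + 1
    1+D≡D+1 = +-comm 1 D

  occurrences-two-levels : ∀ {vs} → All (λ v → v ≡ D ⊎ v ≡ suc D) vs →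
    occurrences (D + 1) vs + occurrences D vs ≡ length vs
  occurrences-two-levels [] = refl
  occurrences-two-levels {vs = _ ∷ vs} (inj₁ refl ∷ levels) = begin
    occurrences (D + 1) (D ∷ vs) + occurrences D (D ∷ vs)
      ≡⟨ cong₂ (λ us ws → length us + length ws) (filter-reject (_≟ D + 1) D≢D+1) (filter-accept (_≟ D) refl) ⟩
    occurrences (D + 1) vs + suc (occurrences D vs)   ≡⟨ +-suc _ _ ⟩
    suc (occurrences (D + 1) vs + occurrences D vs)   ≡⟨ cong suc (occurrences-two-levels levels) ⟩
    suc (length vs)                                   ∎
    where open ≡-Reasoning
  occurrences-two-levels {vs = _ ∷ vs} (inj₂ refl ∷ levels) = begin
    occurrences (D + 1) (suc D ∷ vs) + occurrences D (suc D ∷ vs)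
      ≡⟨ cong₂ (λ us ws → length us + length ws) (filter-accept (_≟ D + 1) 1+D≡D+1) (filter-reject (_≟ D) 1+n≢n) ⟩
    suc (occurrences (D + 1) vs + occurrences D vs)   ≡⟨ cong suc (occurrences-two-levels levels) ⟩
    suc (length vs)                                   ∎
    where open ≡-Reasoning

  sum-two-levels : ∀ {vs} → All (λ v → v ≡ D ⊎ v ≡ suc D) vs →
    length vs * D + occurrences (D + 1) vs ≡ sum vs
  sum-two-levels [] = refl
  sum-two-levels {vs = _ ∷ vs} (inj₁ refl ∷ levels) = begin
    D + length vs * D + occurrences (D + 1) (D ∷ vs)
      ≡⟨ cong (λ us → D + length vs * D + length us) (filter-reject (_≟ D + 1) D≢D+1) ⟩
    D + length vs * D + occurrences (D + 1) vs        ≡⟨ +-assoc D _ _ ⟩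
    D + (length vs * D + occurrences (D + 1) vs)      ≡⟨ cong (D +_) (sum-two-levels levels) ⟩
    D + sum vs                                        ∎
    where open ≡-Reasoning
  sum-two-levels {vs = _ ∷ vs} (inj₂ refl ∷ levels) = begin
    D + length vs * D + occurrences (D + 1) (suc D ∷ vs)
      ≡⟨ cong (λ us → D + length vs * D + length us) (filter-accept (_≟ D + 1) 1+D≡D+1) ⟩
    D + length vs * D + suc (occurrences (D + 1) vs)  ≡⟨ +-suc _ _ ⟩
    suc (D + length vs * D + occurrences (D + 1) vs)  ≡⟨ cong suc (+-assoc D _ _) ⟩
    suc (D + (length vs * D + occurrences (D + 1) vs))  ≡⟨ cong (suc ∘ (D +_)) (sum-two-levels levels) ⟩
    suc D + sum vs                                    ∎
    where open ≡-Reasoning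

  two-level-occurrences : ∀ {vs} m → All (λ v → v ≡ D ⊎ v ≡ suc D) vs →
    length vs ≡ suc m → sum vs ≡ m * D + m →
    occurrences (D + 1) vs ≡ m ∸ D × occurrences D vs ≡ D + 1
  two-level-occurrences {vs} m levels |vs|≡1+m total = c₁≡m∸D , c₀≡D+1
    where
    open ≡-Reasoning
    c₁ c₀ : ℕ
    c₁ = occurrences (D + 1) vs
    c₀ = occurrences D vs
    D+c₁≡m : D + c₁ ≡ m
    D+c₁≡m = +-cancelˡ-≡ (m * D) (D + c₁) m (begin
      m * D + (D + c₁)   ≡⟨ +-assoc (m * D) D c₁ ⟨
      m * D + D + c₁     ≡⟨ cong (_+ c₁) (+-comm (m * D) D) ⟩
      suc m * D + c₁     ≡⟨ cong (λ l → l * D + c₁) |vs|≡1+m ⟨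
      length vs * D + c₁ ≡⟨ sum-two-levels levels ⟩
      sum vs             ≡⟨ total ⟩
      m * D + m          ∎)
    c₁≡m∸D : c₁ ≡ m ∸ D
    c₁≡m∸D = trans (sym (m+n∸m≡n D c₁)) (cong (_∸ D) D+c₁≡m)
    c₀≡D+1 : c₀ ≡ D + 1
    c₀≡D+1 = +-cancelˡ-≡ c₁ c₀ (D + 1) (begin
      c₁ + c₀       ≡⟨ occurrences-two-levels levels ⟩
      length vs     ≡⟨ |vs|≡1+m ⟩
      suc m         ≡⟨ cong suc D+c₁≡m ⟨
      suc D + c₁    ≡⟨ cong (_+ c₁) 1+D≡D+1 ⟩
      D + 1 + c₁    ≡⟨ +-comm (D + 1) c₁ ⟩
      c₁ + (D + 1)  ∎)

shift-<-⇔ : ∀ ℓ {a b} → a < b ⇔ shift ℓ a < shift ℓ b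
shift-<-⇔ ℓ {a} {b} with a <? ℓ | b <? ℓ
... | yes _   | yes _   = mk⇔ id id
... | yes a<ℓ | no b≮ℓ  = mk⇔ m<n⇒m<1+n (λ _ → <-≤-trans a<ℓ (≮⇒≥ b≮ℓ))
... | no a≮ℓ  | yes b<ℓ = mk⇔ (λ a<b → contradiction (<-trans a<b b<ℓ) a≮ℓ) (<-trans (n<1+n a))
... | no _    | no _    = mk⇔ s<s s<s⁻¹

shift-≢ : ∀ ℓ a → shift ℓ a ≢ ℓ
shift-≢ ℓ a with a <? ℓ
... | yes a<ℓ = <⇒≢ a<ℓ
... | no a≮ℓ  = ≢-sym (<⇒≢ (s≤s (≮⇒≥ a≮ℓ)))

insertion-occurrences : ∀ ℓ xs {m D} → length xs ≡ m → descents xs ≡ D →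
  let vs = applyUpTo (λ j → descents (insertAt j ℓ (map (shift ℓ) xs))) (suc m)
  in occurrences (D + 1) vs ≡ m ∸ D × occurrences D vs ≡ D + 1
insertion-occurrences ℓ xs refl refl =
  two-level-occurrences (length xs) levels (length-applyUpTo insertions (suc (length xs))) total
  where
  ys : List ℕ
  ys = map (shift ℓ) xs
  insertions : ℕ → ℕ
  insertions j = descents (insertAt j ℓ ys)
  descents-ys : descents ys ≡ descents xs
  descents-ys = descents-map (shift-<-⇔ ℓ) xs
  levels : All (λ v → v ≡ descents xs ⊎ v ≡ suc (descents xs)) (applyUpTo insertions (suc (length xs)))
  levels = applyUpTo⁺₂ insertions (suc (length xs)) λ j →
    subst (λ d → insertions j ≡ d ⊎ insertions j ≡ suc d) descents-ys (descents-insertAt ℓ ys j)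
  total : sum (applyUpTo insertions (suc (length xs))) ≡ length xs * descents xs + length xs
  total = descents-insertAt-sum (map⁺ (universal (shift-≢ ℓ) xs)) (length-map (shift ℓ) xs) descents-ys

length-filter-map : ∀ {a b p} {A : Set a} {B : Set b} {P : Pred B p} (P? : Decidable P) (f : A → B) xs →
  length (filter P? (map f xs)) ≡ length (filter (P? ∘ f) xs)
length-filter-map P? f [] = refl
length-filter-map P? f (x ∷ xs) with does (P? (f x))
... | true  = cong suc (length-filter-map P? f xs)
... | false = length-filter-map P? f xs

length-filter-∷ : ∀ {a p} {A : Set a} {P : Pred A p} (P? : Decidable P) x xs →
  length (filter P? (x ∷ xs)) ≡ 𝟙 (P? x) + length (filter P? xs)
length-filter-∷ P? x xs with P? x
... | yes _ = refl
... | no _  = refl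

descentsFrom-applyUpTo : ∀ (f : ℕ → ℕ) m →
  descentsFrom (f 0) (applyUpTo (f ∘ suc) m) ≡ length (filter (λ i → f (suc i) <? f i) (upTo m))
descentsFrom-applyUpTo f zero = refl
descentsFrom-applyUpTo f (suc m) = begin
  𝟙 (f 1 <? f 0) + descentsFrom (f 1) (applyUpTo (f ∘ suc ∘ suc) m)
    ≡⟨ cong (𝟙 (f 1 <? f 0) +_) (descentsFrom-applyUpTo (f ∘ suc) m) ⟩
  𝟙 (f 1 <? f 0) + length (filter (descent? ∘ suc) (upTo m))
    ≡⟨ cong (𝟙 (f 1 <? f 0) +_) (length-filter-map descent? suc (upTo m)) ⟨
  𝟙 (f 1 <? f 0) + length (filter descent? (map suc (upTo m)))
    ≡⟨ cong (λ is → 𝟙 (f 1 <? f 0) + length (filter descent? is)) (map-upTo suc m) ⟩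
  𝟙 (f 1 <? f 0) + length (filter descent? (applyUpTo suc m))
    ≡⟨ length-filter-∷ descent? 0 (applyUpTo suc m) ⟨
  length (filter descent? (upTo (suc m))) ∎
  where
  open ≡-Reasoning
  descent? : Decidable (λ i → f (suc i) < f i)
  descent? i = f (suc i) <? f i

des≡descents : ∀ m σ → des m σ ≡ descents (applyUpTo (σ ∘ suc) m)
des≡descents zero σ = refl
des≡descents (suc m) σ =
  trans (length-filter-map (λ i → σ (suc i) <? σ i) suc (upTo m))
        (sym (descentsFrom-applyUpTo (σ ∘ suc) m))

module _ (p : ℕ → ℕ) (k ℓ : ℕ) where

  insert-< : ∀ {i} → i < k → insert p k ℓ i ≡ shift ℓ (p i)
  insert-< {i} i<k with i <? k | i ≟ k
  ... | yes _   | _ = refl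
  ... | no i≮k  | _ = contradiction i<k i≮k

  insert-≡ : insert p k ℓ k ≡ ℓ
  insert-≡ with k <? k | k ≟ k
  ... | yes k<k | _       = contradiction k<k (<-irrefl refl)
  ... | no _    | yes _   = refl
  ... | no _    | no k≢k  = contradiction refl k≢k

  insert-> : ∀ {i} → k < i → insert p k ℓ i ≡ shift ℓ (p (i ∸ 1))
  insert-> {i} k<i with i <? k | i ≟ k
  ... | yes i<k | _       = contradiction i<k (<-asym k<i)
  ... | no _    | yes i≡k = contradiction (sym i≡k) (<⇒≢ k<i)
  ... | no _    | no _    = refl

module _ {a} {A : Set a} where

  applyUpTo-cong-< : ∀ {f g : ℕ → A} n → (∀ {i} → i < n → f i ≡ g i) → applyUpTo f n ≡ applyUpTo g n
  applyUpTo-cong-< zero f≡g = refl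
  applyUpTo-cong-< (suc n) f≡g = cong₂ _∷_ (f≡g z<s) (applyUpTo-cong-< n (f≡g ∘ s<s))

  applyUpTo-insertAt : ∀ {f g : ℕ → A} {v} j n → j ≤ n →
    (∀ {i} → i < j → f i ≡ g i) → f j ≡ v → (∀ {i} → j ≤ i → f (suc i) ≡ g i) →
    applyUpTo f (suc n) ≡ insertAt j v (applyUpTo g n)
  applyUpTo-insertAt zero n _ _ f0≡v after = cong₂ _∷_ f0≡v (applyUpTo-cong-< n (λ _ → after z≤n))
  applyUpTo-insertAt (suc j) (suc n) (s≤s j≤n) before fj≡v after =
    cong₂ _∷_ (before z<s) (applyUpTo-insertAt j n j≤n (before ∘ s<s) fj≡v (after ∘ s≤s))

applyUpTo-insert : ∀ (p : ℕ → ℕ) ℓ {j n} → j ≤ n →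
  applyUpTo (insert p (suc j) ℓ ∘ suc) (suc n) ≡ insertAt j ℓ (map (shift ℓ) (applyUpTo (p ∘ suc) n))
applyUpTo-insert p ℓ {j} {n} j≤n = trans
  (applyUpTo-insertAt j n j≤n
    (insert-< p (suc j) ℓ ∘ s<s) (insert-≡ p (suc j) ℓ) (insert-> p (suc j) ℓ ∘ s<s ∘ s≤s))
  (sym (cong (insertAt j ℓ) (map-applyUpTo (p ∘ suc) (shift ℓ) n)))

map-range1 : ∀ {a} {A : Set a} (f : ℕ → A) m → map f (range1 m) ≡ applyUpTo (f ∘ suc) m
map-range1 f m = trans (sym (map-∘ (upTo m))) (map-upTo (f ∘ suc) m)

count≡occurrences : ∀ (g : ℕ → ℕ) c m →
  count (λ k → g k ≡ c) (λ k → g k ≟ c) m ≡ occurrences c (map g (range1 m))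
count≡occurrences g c m = sym (length-filter-map (_≟ c) g (range1 m))

lemma7p1 : (n : ℕ) → n ≥ 1 → (π : Permutation′ n) → (ℓ : ℕ) → 1 ≤ ℓ → ℓ ≤ suc n →
    (count (λ k → des (suc n) (insert (asFun π) k ℓ) ≡ des n (asFun π) + 1)
        (λ k → des (suc n) (insert (asFun π) k ℓ) ≟ des n (asFun π) + 1) (suc n)
      ≡ n ∸ des n (asFun π))
    × (count (λ k → des (suc n) (insert (asFun π) k ℓ) ≡ des n (asFun π))
        (λ k → des (suc n) (insert (asFun π) k ℓ) ≟ des n (asFun π)) (suc n)
      ≡ des n (asFun π) + 1)
lemma7p1 n _ π ℓ _ _ =
  let rises , stays = insertion-occurrences ℓ xs (length-applyUpTo (p ∘ suc) n) (sym (des≡descents n p))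
  in trans (count≡ (D + 1)) rises , trans (count≡ D) stays
  where
  p : ℕ → ℕ
  p = asFun π
  D : ℕ
  D = des n p
  xs : List ℕ
  xs = applyUpTo (p ∘ suc) n
  g : ℕ → ℕ
  g k = des (suc n) (insert p k ℓ)

  vs : List ℕ
  vs = applyUpTo (λ j → descents (insertAt j ℓ (map (shift ℓ) xs))) (suc n)

  values : map g (range1 (suc n)) ≡ vs
  values = trans (map-range1 g (suc n)) (applyUpTo-cong-< (suc n) λ {j} j<1+n →
    trans (des≡descents (suc n) (insert p (suc j) ℓ)) (cong descents (applyUpTo-insert p ℓ (m<1+n⇒m≤n j<1+n))))

  count≡ : ∀ c → count (λ k → g k ≡ c) (λ k → g k ≟ c) (suc n) ≡ occurrences c vs
  count≡ c = trans (count≡occurrences g c (suc n)) (cong (occurrences c) values)
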